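{- Let $k\ge 0$, $n=2^k$, $s\in[[0,n-1]]$, and let $t_i,l_i,\beta_i,\mathrm{last}$ be as defined in the context. If $i\in[[0,\mathrm{last}-1]]$ and $\beta_i=\rho\gamma$ for binary strings $\rho,\gamma$ with $|\gamma|=|\beta_{i+1}|$, then $(\gamma)_2\le(\beta_{i+1})_2$.
   Context: $[[a,b]]=\{x\in\mathbb Z: a\le x\le b\}$. For an integer $x$, $\mathrm{bin}_k(x)$ is the length-$k$ binary string (most significant bit first) representing $x\bmod 2^k$; for a binary string $\alpha$, $(\alpha)_2$ is the number it represents (the empty string represents $0$), $|\alpha|$ its length, $(0)^d$ the string of $d$ zeros, and juxtaposition denotes concatenation. $\mathrm{rev}_k(x)$ is the integer whose $k$-bit binary representation is the reversal of $\mathrm{bin}_k(x)$; for a set $S$, $\mathrm{rev}_kS=\{\mathrm{rev}_k(x):x\in S\}$. Define $t_0=s$ and for $i\ge 0$: $l_i=\max\{l\in[[0,k]]: t_i\equiv 0 \pmod{2^l}\}$, $t_{i+1}=t_i+2^{l_i}$. Let $\mathrm{last}=\min\{i\ge 0: l_i=k\}$. For $i\in[[0,\mathrm{last}]]$, $\beta_i$ is the binary string of length $k-l_i$ such that $\mathrm{rev}_k(t_i)=((0)^{l_i}\beta_i)_2$. -}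

module Defs where

open import Data.Nat using (ℕ; zero; suc; _+_; _*_; _^_; _/_; _%_)
open import Data.Bool using (Bool; true; false; if_then_else_)
open import Data.List using (List; []; _∷_; _++_; reverse; foldl; replicate)

-- Binary strings are lists of booleans, most significant bit first.
BinStr : Set
BinStr = List Bool

bit : Bool → ℕ
bit true  = 1
bit false = 0

val : BinStr → ℕ
val = foldl (λ acc b → 2 * acc + bit b) 0

-- bin_k(x) : length-k binary string of x mod 2^k, MSB first.
bin : ℕ → ℕ → BinStr
bin zero    x = []
bin (suc k) x = bin k (x / 2) ++ ((x % 2 Data.Nat.≡ᵇ 1) ∷ [])

rev : ℕ → ℕ → ℕ
rev k x = val (reverse (bin k x))

zeros : ℕ → BinStr
zeros d = replicate d false

-- l for a value x : max{ l ∈ [[0,k]] : 2^l ∣ x }  (computed by recursion on k)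
lv : ℕ → ℕ → ℕ
lv zero    x = 0
lv (suc k) x = if x % 2 Data.Nat.≡ᵇ 0 then suc (lv k (x / 2)) else 0

mutual
  t : ℕ → ℕ → ℕ → ℕ
  t k s zero    = s
  t k s (suc i) = t k s i + 2 ^ l k s i

  l : ℕ → ℕ → ℕ → ℕ
  l k s i = lv k (t k s i)

-- Read t_i least significant bit first, so that rev_k(t_i) is the value of this
-- bit list and l_i counts its leading zeros.  Then t_i = 0^l 1 c with β_i = 1 c,
-- and adding 2^l carries into a single position: t_{i+1} = 0^{l+1} (c + 1), so
-- β_{i+1} is c + 1 with its leading zeros removed.  Writing c = 1^m 0 d gives
-- β_{i+1} = 1 d, while the suffix of β_i = 1 1^m 0 d of the same length is 0 d;
-- if c = 1^m, then β_{i+1} is empty.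
module Submission where

open import Defs
open import Data.Bool using (true; false)
open import Data.Empty using (⊥-elim)
open import Data.List using (List; []; _∷_; _++_; [_]; length; reverse; foldl)
open import Data.List.Properties using (++-assoc; ++-cancelˡ; length-++; length-replicate; reverse-++)
open import Data.List.Relation.Binary.Pointwise using (Pointwise-≡⇒≡; ≡⇒Pointwise-≡)
open import Data.List.Relation.Binary.Suffix.Heterogeneous using (here)
import Data.List.Relation.Binary.Suffix.Heterogeneous.Properties as Suffix
open import Data.Nat using (ℕ; zero; suc; _+_; _*_; _^_; _∸_; _/_; _%_; _≡ᵇ_; _<_; _≤_; z≤n; s≤s)
open import Data.Nat.DivMod
  using (m≡m%n+[m/n]*n; m%n<n; m<n⇒m%n≡m; [m+kn]%n≡m%n; m<n⇒m/n≡0; m*n/n≡m; +-distrib-/-∣ʳ)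
open import Data.Nat.Divisibility using (divides-refl)
open import Data.Nat.Properties
  using ( suc-injective; +-comm; +-identityʳ; *-identityʳ; +-cancelˡ-≡; +-monoʳ-<; m+[n∸m]≡n
        ; m≤m+n; m≤n+m; <⇒≱; ≤-refl; ≤-trans; <-≤-trans)
open import Data.Nat.Tactic.RingSolver using (solve-∀)
open import Data.Product using (_×_; _,_)
open import Relation.Binary.PropositionalEquality
  using (_≡_; _≢_; refl; sym; trans; cong; cong₂; subst; subst₂; module ≡-Reasoning)
open import Relation.Nullary using (¬_)

open ≡-Reasoning

private variable
  A : Set

++-cancel-suffix : {as bs cs ds : List A} → length cs ≡ length ds → as ++ cs ≡ bs ++ ds → cs ≡ ds
++-cancel-suffix len eq = Pointwise-≡⇒≡ (Suffix.++⁻ len (here (≡⇒Pointwise-≡ eq)))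

foldl-val : ∀ a xs → foldl (λ acc b → 2 * acc + bit b) a xs ≡ a * 2 ^ length xs + val xs
foldl-val a [] = sym (trans (+-identityʳ (a * 1)) (*-identityʳ a))
foldl-val a (b ∷ xs) = begin
  foldl _ (2 * a + bit b) xs          ≡⟨ foldl-val (2 * a + bit b) xs ⟩
  (2 * a + bit b) * P + val xs        ≡⟨ shift a (bit b) P (val xs) ⟩
  a * (2 * P) + (bit b * P + val xs)  ≡⟨ cong (a * (2 * P) +_) (foldl-val (bit b) xs) ⟨
  a * (2 * P) + val (b ∷ xs)          ∎
  where
  P = 2 ^ length xs
  shift : ∀ a c P v → (2 * a + c) * P + v ≡ a * (2 * P) + (c * P + v)
  shift = solve-∀

val-∷ : ∀ b xs → val (b ∷ xs) ≡ bit b * 2 ^ length xs + val xs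
val-∷ b xs = foldl-val (bit b) xs

digit-bound : ∀ b {P v} → v < P → bit b * P + v < 2 * P
digit-bound false {P} v<P = <-≤-trans v<P (m≤m+n P (P + 0))
digit-bound true  {P} {v} v<P = subst (P + 0 + v <_) (+-comm (P + 0) P) (+-monoʳ-< (P + 0) v<P)

digit-injective : ∀ b c {P u v} → u < P → v < P → bit b * P + u ≡ bit c * P + v → b ≡ c × u ≡ v
digit-injective false false _ _ eq = refl , eq
digit-injective true  true  {P} _ _ eq = refl , +-cancelˡ-≡ (P + 0) _ _ eq
digit-injective false true  {P} u<P _ eq =
  ⊥-elim (<⇒≱ u<P (subst (P ≤_) (sym eq) (≤-trans (m≤m+n P 0) (m≤m+n _ _))))
digit-injective true  false {P} _ v<P eq =
  ⊥-elim (<⇒≱ v<P (subst (P ≤_) eq (≤-trans (m≤m+n P 0) (m≤m+n _ _))))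

val<2^length : ∀ xs → val xs < 2 ^ length xs
val<2^length [] = s≤s z≤n
val<2^length (b ∷ xs) = subst (_< 2 ^ length (b ∷ xs)) (sym (val-∷ b xs)) (digit-bound b (val<2^length xs))

val-injective : {xs ys : BinStr} → length xs ≡ length ys → val xs ≡ val ys → xs ≡ ys
val-injective {[]}     {[]}     _   _  = refl
val-injective {b ∷ xs} {c ∷ ys} len eq =
  let (b≡c , tail≡) = digit-injective b c (val<2^length xs) ys-bound digits≡
  in cong₂ _∷_ b≡c (val-injective len′ tail≡)
  where
  len′ : length xs ≡ length ys
  len′ = suc-injective len
  digits≡ : bit b * 2 ^ length xs + val xs ≡ bit c * 2 ^ length xs + val ys
  digits≡ = begin
    bit b * 2 ^ length xs + val xs  ≡⟨ val-∷ b xs ⟨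
    val (b ∷ xs)                    ≡⟨ eq ⟩
    val (c ∷ ys)                    ≡⟨ val-∷ c ys ⟩
    bit c * 2 ^ length ys + val ys  ≡⟨ cong (λ n → bit c * 2 ^ n + val ys) len′ ⟨
    bit c * 2 ^ length xs + val ys  ∎
  ys-bound : val ys < 2 ^ length xs
  ys-bound = subst (λ n → val ys < 2 ^ n) (sym len′) (val<2^length ys)

val-false∷≤val-true∷ : ∀ xs → val (false ∷ xs) ≤ val (true ∷ xs)
val-false∷≤val-true∷ xs = subst₂ _≤_ (sym (val-∷ false xs)) (sym (val-∷ true xs)) (m≤n+m (val xs) _)

bits : ℕ → ℕ → BinStr
bits k x = reverse (bin k x)

bits-suc : ∀ k x → bits (suc k) x ≡ (x % 2 ≡ᵇ 1) ∷ bits k (x / 2)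
bits-suc k x = reverse-++ (bin k (x / 2)) [ x % 2 ≡ᵇ 1 ]

length-bits : ∀ k x → length (bits k x) ≡ k
length-bits zero    x = refl
length-bits (suc k) x = trans (cong length (bits-suc k x)) (cong suc (length-bits k (x / 2)))

data BitView : ℕ → Set where
  _∷ᵇ_ : ∀ b q → BitView (bit b + q * 2)

bitView : ∀ x → BitView x
bitView x with x % 2 | m≡m%n+[m/n]*n x 2 | m%n<n x 2
... | 0 | x≡ | _ = subst BitView (sym x≡) (false ∷ᵇ (x / 2))
... | 1 | x≡ | _ = subst BitView (sym x≡) (true ∷ᵇ (x / 2))
... | suc (suc _) | _ | s≤s (s≤s ())

bit<2 : ∀ b → bit b < 2
bit<2 false = s≤s z≤n
bit<2 true  = s≤s (s≤s z≤n)

bit-%2 : ∀ b q → (bit b + q * 2) % 2 ≡ bit b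
bit-%2 b q = trans ([m+kn]%n≡m%n (bit b) q 2) (m<n⇒m%n≡m (bit<2 b))

bit-/2 : ∀ b q → (bit b + q * 2) / 2 ≡ q
bit-/2 b q = trans (+-distrib-/-∣ʳ (bit b) (divides-refl q)) (cong₂ _+_ (m<n⇒m/n≡0 (bit<2 b)) (m*n/n≡m q 2))

bit≡ᵇ1 : ∀ b → (bit b ≡ᵇ 1) ≡ b
bit≡ᵇ1 false = refl
bit≡ᵇ1 true  = refl

bits-bit∷ : ∀ k b q → bits (suc k) (bit b + q * 2) ≡ b ∷ bits k q
bits-bit∷ k b q = begin
  bits (suc k) x                 ≡⟨ bits-suc k x ⟩
  (x % 2 ≡ᵇ 1) ∷ bits k (x / 2)  ≡⟨ cong₂ _∷_ lowest-bit (cong (bits k) (bit-/2 b q)) ⟩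
  b ∷ bits k q                   ∎
  where
  x = bit b + q * 2
  lowest-bit : (x % 2 ≡ᵇ 1) ≡ b
  lowest-bit = trans (cong (_≡ᵇ 1) (bit-%2 b q)) (bit≡ᵇ1 b)

leadingZeros : BinStr → ℕ
leadingZeros []           = 0
leadingZeros (false ∷ xs) = suc (leadingZeros xs)
leadingZeros (true  ∷ xs) = 0

significant : BinStr → BinStr
significant []           = []
significant (false ∷ xs) = significant xs
significant (true  ∷ xs) = true ∷ xs

leadingZeros≤length : ∀ xs → leadingZeros xs ≤ length xs
leadingZeros≤length []           = z≤n
leadingZeros≤length (false ∷ xs) = s≤s (leadingZeros≤length xs)
leadingZeros≤length (true  ∷ xs) = z≤n

zeros-++-significant : ∀ xs → xs ≡ zeros (leadingZeros xs) ++ significant xs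
zeros-++-significant []           = refl
zeros-++-significant (false ∷ xs) = cong (false ∷_) (zeros-++-significant xs)
zeros-++-significant (true  ∷ xs) = refl

significant-unique : ∀ {k L} xs β → length xs ≡ k → L ≡ leadingZeros xs
  → length β ≡ k ∸ L → val xs ≡ val (zeros L ++ β) → β ≡ significant xs
significant-unique xs β refl refl lenβ eq =
  ++-cancelˡ (zeros L) β (significant xs) (trans (sym xs≡) (zeros-++-significant xs))
  where
  L = leadingZeros xs
  length≡ : length xs ≡ length (zeros L ++ β)
  length≡ = sym (begin
    length (zeros L ++ β)          ≡⟨ length-++ (zeros L) ⟩
    length (zeros L) + length β    ≡⟨ cong₂ _+_ (length-replicate L) lenβ ⟩
    L + (length xs ∸ L)            ≡⟨ m+[n∸m]≡n (leadingZeros≤length xs) ⟩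
    length xs                      ∎)
  xs≡ : xs ≡ zeros L ++ β
  xs≡ = val-injective length≡ eq

lv≡leadingZeros-bits : ∀ k x → lv k x ≡ leadingZeros (bits k x)
lv≡leadingZeros-bits zero    x = refl
lv≡leadingZeros-bits (suc k) x with bitView x
... | b ∷ᵇ q = trans (lv-bit∷ b) (cong leadingZeros (sym (bits-bit∷ k b q)))
  where
  lv-bit∷ : ∀ b → lv (suc k) (bit b + q * 2) ≡ leadingZeros (b ∷ bits k q)
  lv-bit∷ b rewrite bit-%2 b q | bit-/2 b q with b
  ... | false = cong suc (lv≡leadingZeros-bits k q)
  ... | true  = refl

-- Least significant bit first; the final carry is discarded, as in x mod 2^k.
increment : BinStr → BinStr
increment []           = []
increment (false ∷ xs) = true ∷ xs
increment (true  ∷ xs) = false ∷ increment xs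

incrementAt : ℕ → BinStr → BinStr
incrementAt zero    xs       = increment xs
incrementAt (suc j) []       = []
incrementAt (suc j) (b ∷ xs) = b ∷ incrementAt j xs

incrementAt-[] : ∀ j → incrementAt j [] ≡ []
incrementAt-[] zero    = refl
incrementAt-[] (suc j) = refl

bits-+2^ : ∀ k j x → bits k (x + 2 ^ j) ≡ incrementAt j (bits k x)
bits-+2^ zero j x = sym (incrementAt-[] j)
bits-+2^ (suc k) zero x with bitView x
... | false ∷ᵇ q = begin
  bits (suc k) (q * 2 + 1)      ≡⟨ cong (bits (suc k)) (+-comm (q * 2) 1) ⟩
  bits (suc k) (1 + q * 2)      ≡⟨ bits-bit∷ k true q ⟩
  true ∷ bits k q               ≡⟨ cong increment (bits-bit∷ k false q) ⟨
  increment (bits (suc k) x)    ∎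
... | true ∷ᵇ q = begin
  bits (suc k) (1 + q * 2 + 1)  ≡⟨ cong (λ n → bits (suc k) (suc n)) (+-comm (q * 2) 1) ⟩
  bits (suc k) (suc q * 2)      ≡⟨ bits-bit∷ k false (suc q) ⟩
  false ∷ bits k (suc q)        ≡⟨ cong (λ n → false ∷ bits k n) (+-comm 1 q) ⟩
  false ∷ bits k (q + 1)        ≡⟨ cong (false ∷_) (bits-+2^ k zero q) ⟩
  increment (true ∷ bits k q)   ≡⟨ cong increment (bits-bit∷ k true q) ⟨
  increment (bits (suc k) x)    ∎
bits-+2^ (suc k) (suc j) x with bitView x
... | b ∷ᵇ q = begin
  bits (suc k) (bit b + q * 2 + 2 * 2 ^ j)  ≡⟨ cong (bits (suc k)) (carry (bit b) q (2 ^ j)) ⟩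
  bits (suc k) (bit b + (q + 2 ^ j) * 2)    ≡⟨ bits-bit∷ k b (q + 2 ^ j) ⟩
  b ∷ bits k (q + 2 ^ j)                    ≡⟨ cong (b ∷_) (bits-+2^ k j q) ⟩
  incrementAt (suc j) (b ∷ bits k q)        ≡⟨ cong (incrementAt (suc j)) (bits-bit∷ k b q) ⟨
  incrementAt (suc j) (bits (suc k) x)      ∎
  where
  carry : ∀ a q P → a + q * 2 + 2 * P ≡ a + (q + P) * 2
  carry = solve-∀

next : BinStr → BinStr
next xs = incrementAt (leadingZeros xs) xs

suffix≤significant-increment : ∀ c p ρ γ → ρ ++ γ ≡ p ++ c
  → length γ ≡ length (significant (increment c)) → val γ ≤ val (significant (increment c))
suffix≤significant-increment []          p ρ [] _ _ = z≤n
suffix≤significant-increment (false ∷ d) p ρ γ split len =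
  subst (λ γ → val γ ≤ val (true ∷ d)) (sym (++-cancel-suffix {as = ρ} {bs = p} len split))
    (val-false∷≤val-true∷ d)
suffix≤significant-increment (true ∷ d)  p ρ γ split len =
  suffix≤significant-increment d (p ++ [ true ]) ρ γ (trans split (sym (++-assoc p [ true ] d))) len

suffix-of-significant≤significant-next : ∀ xs ρ γ → leadingZeros xs ≢ length xs
  → significant xs ≡ ρ ++ γ → length γ ≡ length (significant (next xs))
  → val γ ≤ val (significant (next xs))
suffix-of-significant≤significant-next []           ρ γ nonzero = ⊥-elim (nonzero refl)
suffix-of-significant≤significant-next (false ∷ xs) ρ γ nonzero =
  suffix-of-significant≤significant-next xs ρ γ (λ eq → nonzero (cong suc eq))
suffix-of-significant≤significant-next (true ∷ c)   ρ γ _ split =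
  suffix≤significant-increment c [ true ] ρ γ (sym split)

bits-next : ∀ k x → bits k (x + 2 ^ lv k x) ≡ next (bits k x)
bits-next k x =
  trans (bits-+2^ k (lv k x) x) (cong (λ j → incrementAt j (bits k x)) (lv≡leadingZeros-bits k x))

suffix-of-β≤β-next : ∀ k x {βi βi1 ρ γ} → lv k x ≢ k
  → length βi ≡ k ∸ lv k x → rev k x ≡ val (zeros (lv k x) ++ βi)
  → length βi1 ≡ k ∸ lv k (x + 2 ^ lv k x)
  → rev k (x + 2 ^ lv k x) ≡ val (zeros (lv k (x + 2 ^ lv k x)) ++ βi1)
  → βi ≡ ρ ++ γ → length γ ≡ length βi1 → val γ ≤ val βi1
suffix-of-β≤β-next k x {βi} {βi1} {ρ} {γ} not-last lenβi revβi lenβi1 revβi1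
  with refl ← significant-unique (bits k x) βi (length-bits k x) (lv≡leadingZeros-bits k x) lenβi revβi
     | refl ← trans (significant-unique (bits k (x + 2 ^ lv k x)) βi1 (length-bits k _) (lv≡leadingZeros-bits k _)
                           lenβi1 revβi1)
                    (cong significant (bits-next k x))
  = suffix-of-significant≤significant-next (bits k x) ρ γ nonzero
  where
  nonzero : leadingZeros (bits k x) ≢ length (bits k x)
  nonzero eq = not-last (trans (lv≡leadingZeros-bits k x) (trans eq (length-bits k x)))

lemma1 : (k s i : ℕ) → s < 2 ^ k
    → (∀ j → j ≤ i → ¬ (l k s j ≡ k))
    → (βi βi1 ρ γ : BinStr)
    → length βi ≡ k ∸ l k s i
    → rev k (t k s i) ≡ val (zeros (l k s i) ++ βi)
    → length βi1 ≡ k ∸ l k s (Data.Nat.suc i)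
    → rev k (t k s (Data.Nat.suc i)) ≡ val (zeros (l k s (Data.Nat.suc i)) ++ βi1)
    → βi ≡ ρ ++ γ
    → length γ ≡ length βi1
    → val γ ≤ val βi1
lemma1 k s i _ before-last _ _ ρ γ = suffix-of-β≤β-next k (t k s i) {ρ = ρ} {γ = γ} (before-last i ≤-refl)
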